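{- Let $F$ and $g$ be positive integers and let $S \in \mathcal{E}(F,g)$. Then the directed graph $\mathcal{G}([S])$ is a tree with root $S$; that is, for every vertex $P \in [S]$ with $P \neq S$ there is a unique path from $P$ to $S$.
   Context: A numerical semigroup is a subset $S \subseteq \mathbb{N}$ (with $\mathbb{N}$ the nonnegative integers) closed under addition, containing $0$, with $\mathbb{N}\setminus S$ finite. The genus of $S$ is $\#(\mathbb{N}\setminus S)$; the Frobenius number $\mathrm{F}(S)$ is the largest integer not in $S$; the multiplicity $\mathrm{m}(S)$ is the least positive integer in $S$. $S$ is elementary if $\mathrm{F}(S) < 2\,\mathrm{m}(S)$. $\mathcal{S}(F,g)$ (resp. $\mathcal{E}(F,g)$) denotes the set of (resp. elementary) numerical semigroups with Frobenius number $F$ and genus $g$. For $S \in \mathcal{S}(F,g)$ let $\theta(S) = \left(S \setminus \{x \in S\setminus\{0\} : x < \frac{F}{2}\}\right) \cup \{F - x : x \in S\setminus\{0\},\ x < \frac{F}{2}\}$ and $[S] = \{S' \in \mathcal{S}(F,g) : \theta(S') = \theta(S)\}$. The directed graph $\mathcal{G}([S])$ has vertex set $[S]$, and $(P,Q) \in [S]\times[S]$ is an edge iff $F > 2\,\mathrm{m}(P)$ and $Q = (P \setminus \{\mathrm{m}(P)\}) \cup \{F - \mathrm{m}(P)\}$. A path from $v$ to $w$ is a finite sequence of distinct edges $(v_0,v_1),(v_1,v_2),\ldots,(v_{n-1},v_n)$ with $v_0 = v$, $v_n = w$. A directed graph is a tree with root $r$ if for every other vertex $v$ there is a unique path connecting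 $v$ to $r$. -}

module Defs where

open import Data.Nat using (ℕ; zero; suc; _+_; _*_; _∸_; _<_; _≡ᵇ_)
open import Data.Bool using (Bool; true; false; _∧_; _∨_; not)
open import Data.Vec using (Vec; []; _∷_)
open import Data.List using (List; []; _∷_)
open import Data.List.Relation.Unary.Unique.Propositional using (Unique)
open import Data.Product using (Σ; _×_; _,_)
open import Data.Sum using (_⊎_)
open import Data.Unit using (⊤)
open import Relation.Nullary using (¬_)
open import Relation.Binary.PropositionalEquality using (_≡_; _≢_)

-- Encoding: a numerical semigroup S with Frobenius number F is determined by
-- its membership of 0,1,…,F (every integer > F belongs to S).

NS : ℕ → Set
NS F = Vec Bool (suc F)

memV : ∀ {n} → Vec Bool n → ℕ → Bool
memV []      _       = true
memV (b ∷ v) zero    = b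
memV (b ∷ v) (suc x) = memV v x

mem : ∀ {F} → NS F → ℕ → Bool
mem v x = memV v x

_∈ₛ_ : ∀ {F} → ℕ → NS F → Set
x ∈ₛ v = mem v x ≡ true

IsNumSemigroup : (F : ℕ) → NS F → Set
IsNumSemigroup F v =
  (0 ∈ₛ v) × (mem v F ≡ false) × (∀ x y → x ∈ₛ v → y ∈ₛ v → (x + y) ∈ₛ v)

countGaps : ∀ {n} → Vec Bool n → ℕ
countGaps []          = 0
countGaps (true ∷ v)  = countGaps v
countGaps (false ∷ v) = suc (countGaps v)

genus : ∀ {F} → NS F → ℕ
genus v = countGaps v

IsMultiplicity : ∀ {F} → NS F → ℕ → Set
IsMultiplicity v m = (0 < m) × (m ∈ₛ v) × (∀ y → 0 < y → y < m → mem v y ≡ false)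

IsElementary : (F : ℕ) → NS F → Set
IsElementary F v = Σ ℕ λ m → IsMultiplicity v m × (F < 2 * m)

InSFg : (F g : ℕ) → NS F → Set
InSFg F g v = IsNumSemigroup F v × (genus v ≡ g)

InEFg : (F g : ℕ) → NS F → Set
InEFg F g v = InSFg F g v × IsElementary F v

-- membership in θ(S) (x < F/2 written as 2x < F)
ThetaMem : (F : ℕ) → NS F → ℕ → Set
ThetaMem F v y =
  ((y ∈ₛ v) × ¬ ((0 < y) × (2 * y < F)))
  ⊎ (Σ ℕ λ x → (x ∈ₛ v) × (0 < x) × (2 * x < F) × (y ≡ F ∸ x))

SameTheta : (F : ℕ) → NS F → NS F → Set
SameTheta F P Q = ∀ y → (ThetaMem F P y → ThetaMem F Q y) × (ThetaMem F Q y → ThetaMem F P y)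

InClass : (F g : ℕ) → NS F → NS F → Set
InClass F g S P = InSFg F g P × SameTheta F P S

Edge : (F : ℕ) → NS F → NS F → Set
Edge F P Q = Σ ℕ λ m → IsMultiplicity P m × (2 * m < F) ×
  (∀ x → mem Q x ≡ ((mem P x ∧ not (x ≡ᵇ m)) ∨ (x ≡ᵇ (F ∸ m))))

-- generic paths in a directed graph with vertex predicate C and edge relation E.
-- A path from v is given by its list of subsequent vertices v1,…,vn.
module _ {V : Set} (C : V → Set) (E : V → V → Set) where

  WalkFrom : V → List V → Set
  WalkFrom x []       = ⊤
  WalkFrom x (y ∷ ys) = E x y × C y × WalkFrom y ys

  lastV : V → List V → V
  lastV x []       = x
  lastV x (y ∷ ys) = lastV y ys

  edgesOf : V → List V → List (V × V)
  edgesOf x []       = []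
  edgesOf x (y ∷ ys) = (x , y) ∷ edgesOf y ys

  IsPath : V → V → List V → Set
  IsPath v w ys = C v × WalkFrom v ys × (lastV v ys ≡ w) × Unique (edgesOf v ys)

  IsTreeWithRoot : V → Set
  IsTreeWithRoot r = ∀ v → C v → v ≢ r →
    Σ (List V) λ ys → IsPath v r ys × (∀ zs → IsPath v r zs → zs ≡ ys)

GraphIsTreeWithRoot : (F g : ℕ) → NS F → Set
GraphIsTreeWithRoot F g S = IsTreeWithRoot (InClass F g S) (Edge F) S

-- The edge out of P ∈ [S] replaces m = m(P), when 2m < F, by F − m.  This preserves the
-- genus and θ, so it stays in [S], and it strictly raises the multiplicity.  Following
-- edges from P therefore ends at a semigroup with no positive element below F/2; θ fixes
-- such a semigroup, and also S since S is elementary, so the walk ends at S.  Uniqueness: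
-- each vertex has at most one outgoing edge and S has none (2 m(S) > F); the edges of a
-- walk are distinct because the multiplicity increases along it.
module Submission where

open import Defs
open import Data.Nat using (ℕ; zero; suc; _+_; _*_; _∸_; _≤_; _<_; z≤n; s≤s; z<s; _≡ᵇ_; _<?_; _≟_)
open import Data.Nat.Properties
open import Data.Bool using (Bool; true; false; _∧_; _∨_; not)
open import Data.Bool.Properties using (∨-identityʳ; ∨-zeroʳ; ∧-identityʳ; ∧-zeroʳ; T-≡)
open import Data.Vec using (Vec; []; _∷_)
open import Data.List using (List; []; _∷_)
open import Data.List.Relation.Unary.All as All using (All; []; _∷_)
open import Data.List.Relation.Unary.Unique.Propositional using (Unique)
open import Data.List.Relation.Unary.AllPairs using ([]; _∷_)
open import Data.Product using (Σ; _×_; _,_; proj₁; proj₂)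
open import Data.Sum using (_⊎_; inj₁; inj₂)
open import Data.Unit using (tt)
open import Data.Empty using (⊥-elim)
open import Function using (_∘_; Equivalence)
open import Relation.Nullary using (¬_; yes; no)
open import Relation.Nullary.Decidable using (dec-true; dec-false)
open import Relation.Binary.Definitions using (Transitive; Irreflexive)
open import Relation.Binary.PropositionalEquality

true≢false : true ≢ false
true≢false ()

memV-beyond : ∀ {n} (v : Vec Bool n) x → n ≤ x → memV v x ≡ true
memV-beyond []      x       _       = refl
memV-beyond (b ∷ v) (suc x) (s≤s p) = memV-beyond v x p

memV-ext : ∀ {n} (v w : Vec Bool n) → (∀ x → memV v x ≡ memV w x) → v ≡ w
memV-ext []      []      _  = refl
memV-ext (a ∷ v) (b ∷ w) eq = cong₂ _∷_ (eq 0) (memV-ext v w (eq ∘ suc))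

tabulateℕ : (n : ℕ) → (ℕ → Bool) → Vec Bool n
tabulateℕ zero    f = []
tabulateℕ (suc n) f = f 0 ∷ tabulateℕ n (f ∘ suc)

memV-tabulateℕ : ∀ n f → (∀ x → n ≤ x → f x ≡ true) → ∀ x → memV (tabulateℕ n f) x ≡ f x
memV-tabulateℕ zero    f big x       = sym (big x z≤n)
memV-tabulateℕ (suc n) f big zero    = refl
memV-tabulateℕ (suc n) f big (suc x) =
  memV-tabulateℕ n (f ∘ suc) (λ y n≤y → big (suc y) (s≤s n≤y)) x

countGaps-cons : ∀ {n} b {v w : Vec Bool n} →
  countGaps w ≡ suc (countGaps v) → countGaps (b ∷ w) ≡ suc (countGaps (b ∷ v))
countGaps-cons true  eq = eq
countGaps-cons false eq = cong suc eq

countGaps-clear : ∀ {n} (v w : Vec Bool n) a → (∀ x → x ≢ a → memV w x ≡ memV v x) →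
  memV v a ≡ true → memV w a ≡ false → countGaps w ≡ suc (countGaps v)
countGaps-clear (_ ∷ v) (_ ∷ w) zero agree refl refl =
  cong (suc ∘ countGaps) (memV-ext w v (λ x → agree (suc x) λ ()))
countGaps-clear (b ∷ v) (c ∷ w) (suc a) agree va wa with agree 0 (λ ())
... | refl = countGaps-cons b
  (countGaps-clear v w a (λ x x≢a → agree (suc x) (x≢a ∘ suc-injective)) va wa)

≡ᵇ-true⇒≡ : ∀ {x y} → (x ≡ᵇ y) ≡ true → x ≡ y
≡ᵇ-true⇒≡ {x} {y} eq = ≡ᵇ⇒≡ x y (Equivalence.from T-≡ eq)

2m<n⇒m<n∸m : ∀ {m n} → 2 * m < n → m < n ∸ m
2m<n⇒m<n∸m {m} lt = m+n≤o⇒m≤o∸n (suc m) (subst (λ k → suc (m + k) ≤ _) (+-identityʳ m) lt)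

2m<n⇒n<2[n∸m] : ∀ {m n} → 2 * m < n → n < 2 * (n ∸ m)
2m<n⇒n<2[n∸m] {m} {n} lt = begin-strict
  n                 ≡⟨ m+[n∸m]≡n (≤-trans (m≤m+n m _) (<⇒≤ lt)) ⟨
  m + (n ∸ m)       <⟨ +-monoˡ-< (n ∸ m) (2m<n⇒m<n∸m lt) ⟩
  n ∸ m + (n ∸ m)   ≡⟨ cong (n ∸ m +_) (+-identityʳ (n ∸ m)) ⟨
  2 * (n ∸ m)       ∎
  where open ≤-Reasoning

module _ {V : Set} (C : V → Set) (E : V → V → Set) where

  walks-to-sink-unique : ∀ {r} → (∀ x {y z} → E x y → E x z → y ≡ z) → (∀ y → ¬ E r y) →
    ∀ {v} ys zs → WalkFrom C E v ys → WalkFrom C E v zs →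
    lastV C E v ys ≡ r → lastV C E v zs ≡ r → ys ≡ zs
  walks-to-sink-unique functional sink []       []       _       _       _    _    = refl
  walks-to-sink-unique functional sink []       (z ∷ zs) _       (e , _) refl _    = ⊥-elim (sink z e)
  walks-to-sink-unique functional sink (y ∷ ys) []       (e , _) _       _    refl = ⊥-elim (sink y e)
  walks-to-sink-unique functional sink {v} (y ∷ ys) (z ∷ zs) (e , _ , w) (e′ , _ , w′) l l′
    with functional v e e′
  ... | refl = cong (y ∷_) (walks-to-sink-unique functional sink ys zs w w′ l l′)

  module _ {_≺_ : V → V → Set} (≺-trans : Transitive _≺_) (≺-irrefl : Irreflexive _≡_ _≺_)
           (E⇒≺ : ∀ {x y} → E x y → x ≺ y) where

    walk-sources-above : ∀ {v x} ys → v ≺ x → WalkFrom C E x ys →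
      All (λ edge → v ≺ proj₁ edge) (edgesOf C E x ys)
    walk-sources-above []       v≺x _           = []
    walk-sources-above (y ∷ ys) v≺x (e , _ , w) =
      v≺x ∷ walk-sources-above ys (≺-trans v≺x (E⇒≺ e)) w

    walk-edges-unique : ∀ {v} ys → WalkFrom C E v ys → Unique (edgesOf C E v ys)
    walk-edges-unique []       _           = []
    walk-edges-unique (y ∷ ys) (e , _ , w) =
      All.map (λ v≺s eq → ≺-irrefl (cong proj₁ eq) v≺s) (walk-sources-above ys (E⇒≺ e) w)
      ∷ walk-edges-unique ys w

module _ {F : ℕ} where

  Avoids : ℕ → NS F → Set
  Avoids k P = ∀ y → 0 < y → y < k → mem P y ≡ false

  Avoids-one : ∀ {P} → Avoids 1 P
  Avoids-one (suc y) _ (s≤s ())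

  Avoids-extend : ∀ {k P} → Avoids k P → mem P k ≡ false → Avoids (suc k) P
  Avoids-extend {k} av k∉P y 0<y (s≤s y≤k) with m≤n⇒m<n∨m≡n y≤k
  ... | inj₁ y<k  = av y 0<y y<k
  ... | inj₂ refl = k∉P

  Avoids-mono : ∀ (P : NS F) {j k} → j ≤ k → Avoids k P → Avoids j P
  Avoids-mono P j≤k av y 0<y y<j = av y 0<y (<-≤-trans y<j j≤k)

  -- P <ₘ Q says m(P) < m(Q): k is a positive element of P, and Q has none in (0, k].
  data _<ₘ_ (P Q : NS F) : Set where
    mk<ₘ : ∀ k → 0 < k → k ∈ₛ P → Avoids (suc k) Q → P <ₘ Q

  <ₘ-irrefl : Irreflexive _≡_ _<ₘ_
  <ₘ-irrefl refl (mk<ₘ k 0<k k∈P av) = true≢false (trans (sym k∈P) (av k 0<k ≤-refl))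

  <ₘ-trans : Transitive _<ₘ_
  <ₘ-trans {_} {_} {R} (mk<ₘ k 0<k k∈P Q-avoids) (mk<ₘ k′ 0<k′ k′∈Q R-avoids) =
    mk<ₘ k 0<k k∈P (Avoids-mono R (s≤s k≤k′) R-avoids)
    where
    k≤k′ : k ≤ k′
    k≤k′ with k <? k′
    ... | yes k<k′ = <⇒≤ k<k′
    ... | no  k≮k′ = ⊥-elim (true≢false (trans (sym k′∈Q) (Q-avoids k′ 0<k′ (s≤s (≮⇒≥ k≮k′)))))

  multiplicity-minimal : ∀ (P : NS F) {m x} → IsMultiplicity P m → x ∈ₛ P → 0 < x → m ≤ x
  multiplicity-minimal P {x = x} (_ , _ , av) x∈P 0<x =
    ≮⇒≥ λ x<m → true≢false (trans (sym x∈P) (av x 0<x x<m))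

  multiplicity-unique : ∀ (P : NS F) {m m′} → IsMultiplicity P m → IsMultiplicity P m′ → m ≡ m′
  multiplicity-unique P M@(0<m , m∈P , _) M′@(0<m′ , m′∈P , _) =
    ≤-antisym (multiplicity-minimal P M m′∈P 0<m′) (multiplicity-minimal P M′ m∈P 0<m)

  complement-∉ : ∀ {P x} → IsNumSemigroup F P → x ∈ₛ P → x ≤ F → mem P (F ∸ x) ≡ false
  complement-∉ {P} {x} (_ , F∉P , closed) x∈P x≤F with mem P (F ∸ x) in F∸x∈P
  ... | false = refl
  ... | true  = ⊥-elim (true≢false (trans (sym F∈P) F∉P))
    where
    F∈P : F ∈ₛ P
    F∈P = subst (_∈ₛ P) (m+[n∸m]≡n x≤F) (closed x (F ∸ x) x∈P F∸x∈P)

  Edge-functional : ∀ P {Q Q′} → Edge F P Q → Edge F P Q′ → Q ≡ Q′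
  Edge-functional P {Q} {Q′} (m , M , _ , memQ) (m′ , M′ , _ , memQ′)
    with multiplicity-unique P M M′
  ... | refl = memV-ext Q Q′ λ x → trans (memQ x) (sym (memQ′ x))

  Edge-avoids : ∀ {P Q} → ((m , _) : Edge F P Q) → Avoids (suc m) Q
  Edge-avoids {P} (m , (_ , _ , P-avoids) , 2m<F , memQ) y 0<y (s≤s y≤m)
    rewrite memQ y
          | dec-false (y ≟ F ∸ m) (λ { refl → <-irrefl refl (≤-<-trans y≤m (2m<n⇒m<n∸m 2m<F)) })
    with m≤n⇒m<n∨m≡n y≤m
  ... | inj₁ y<m  rewrite P-avoids y 0<y y<m = refl
  ... | inj₂ refl rewrite dec-true (y ≟ y) refl = trans (∨-identityʳ _) (∧-zeroʳ (mem P y))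

  Edge⇒<ₘ : ∀ {P Q} → Edge F P Q → P <ₘ Q
  Edge⇒<ₘ {P} {Q} e@(m , (0<m , m∈P , _) , _) = mk<ₘ m 0<m m∈P (Edge-avoids {P} {Q} e)

  elementary⇒¬Edge : ∀ {S m} → IsMultiplicity S m → F < 2 * m → ∀ Q → ¬ Edge F S Q
  elementary⇒¬Edge {S} M F<2m _ (m′ , M′ , 2m′<F , _) with multiplicity-unique S M M′
  ... | refl = <-asym 2m′<F F<2m

  -- The positive elements below F/2 are exactly those that θ moves.
  SmallFree : NS F → Set
  SmallFree P = ∀ x → x ∈ₛ P → 0 < x → ¬ 2 * x < F

  elementary⇒SmallFree : ∀ {S m} → IsMultiplicity S m → F < 2 * m → SmallFree S
  elementary⇒SmallFree {S} M F<2m x x∈S 0<x 2x<F =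
    <-asym F<2m (≤-<-trans (*-monoʳ-≤ 2 (multiplicity-minimal S M x∈S 0<x)) 2x<F)

  Avoids⇒SmallFree : ∀ {k P} → Avoids k P → ¬ 2 * k < F → SmallFree P
  Avoids⇒SmallFree {k} av 2k≮F x x∈P 0<x 2x<F with x <? k
  ... | yes x<k = true≢false (trans (sym x∈P) (av x 0<x x<k))
  ... | no  x≮k = 2k≮F (≤-<-trans (*-monoʳ-≤ 2 (≮⇒≥ x≮k)) 2x<F)

  ThetaMem-SmallFree : ∀ {P y} → SmallFree P → ThetaMem F P y → y ∈ₛ P
  ThetaMem-SmallFree _  (inj₁ (y∈P , _))                = y∈P
  ThetaMem-SmallFree sf (inj₂ (x , x∈P , 0<x , 2x<F , _)) = ⊥-elim (sf x x∈P 0<x 2x<F)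

  SmallFree⇒ThetaMem : ∀ {P y} → SmallFree P → y ∈ₛ P → ThetaMem F P y
  SmallFree⇒ThetaMem {y = y} sf y∈P = inj₁ (y∈P , λ (0<y , 2y<F) → sf y y∈P 0<y 2y<F)

  SameTheta-SmallFree⇒≡ : ∀ {P S} → SmallFree P → SmallFree S → SameTheta F P S → P ≡ S
  SameTheta-SmallFree⇒≡ {P} {S} sfP sfS same = memV-ext P S λ y → bool-ext
    (λ y∈P → ThetaMem-SmallFree {S} sfS (proj₁ (same y) (SmallFree⇒ThetaMem {P} sfP y∈P)))
    (λ y∈S → ThetaMem-SmallFree {P} sfP (proj₂ (same y) (SmallFree⇒ThetaMem {S} sfS y∈S)))
    where
    bool-ext : ∀ {a b} → (a ≡ true → b ≡ true) → (b ≡ true → a ≡ true) → a ≡ b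
    bool-ext {true}  {true}  _ _ = refl
    bool-ext {false} {false} _ _ = refl
    bool-ext {true}  {false} f _ = sym (f refl)
    bool-ext {false} {true}  _ g = g refl

  SameTheta-trans : ∀ {P Q R} → SameTheta F P Q → SameTheta F Q R → SameTheta F P R
  SameTheta-trans PQ QR y = proj₁ (QR y) ∘ proj₁ (PQ y) , proj₂ (PQ y) ∘ proj₂ (QR y)

  module Move (P : NS F) (P-semigroup : IsNumSemigroup F P) {m : ℕ} (M : IsMultiplicity P m)
              (2m<F : 2 * m < F) where

    private
      0<m : 0 < m
      0<m = proj₁ M

      m∈P : m ∈ₛ P
      m∈P = proj₁ (proj₂ M)

      m<F : m < F
      m<F = ≤-<-trans (m≤m+n m _) 2m<F

      d : ℕ
      d = F ∸ m

      m<d : m < d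
      m<d = 2m<n⇒m<n∸m {m} 2m<F

      F<2d : F < 2 * d
      F<2d = 2m<n⇒n<2[n∸m] {m} 2m<F

      d+m≡F : d + m ≡ F
      d+m≡F = m∸n+n≡m (<⇒≤ m<F)

      d<F : d < F
      d<F = subst (d <_) d+m≡F (m<m+n d 0<m)

      m<z⇒F<d+z : ∀ {z} → m < z → F < d + z
      m<z⇒F<d+z {z} m<z = subst (_< d + z) d+m≡F (+-monoʳ-< d m<z)

      d∉P : mem P d ≡ false
      d∉P = complement-∉ {P} P-semigroup m∈P (<⇒≤ m<F)

    removeM : ℕ → Bool
    removeM x = mem P x ∧ not (x ≡ᵇ m)

    moved : ℕ → Bool
    moved x = removeM x ∨ (x ≡ᵇ d)

    move : NS F
    move = tabulateℕ (suc F) moved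

    removeM-beyond : ∀ x → suc F ≤ x → removeM x ≡ true
    removeM-beyond x F<x
      rewrite memV-beyond P x F<x | dec-false (x ≟ m) (λ { refl → <-asym m<F F<x }) = refl

    mem-move : ∀ x → mem move x ≡ moved x
    mem-move = memV-tabulateℕ (suc F) moved λ x F<x → cong (_∨ (x ≡ᵇ d)) (removeM-beyond x F<x)

    Edge-move : Edge F P move
    Edge-move = m , M , 2m<F , mem-move

    move-elim : ∀ x → x ∈ₛ move → (x ∈ₛ P × x ≢ m) ⊎ x ≡ d
    move-elim x x∈ with mem P x | x ≡ᵇ m in x≡ᵇm | x ≡ᵇ d in x≡ᵇd | trans (sym (mem-move x)) x∈
    ... | _     | _     | true  | _ = inj₂ (≡ᵇ-true⇒≡ x≡ᵇd)
    ... | true  | false | false | _ =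
      inj₁ (refl , λ { refl → true≢false (trans (sym (dec-true (x ≟ x) refl)) x≡ᵇm) })
    ... | true  | true  | false | ()
    ... | false | _     | false | ()

    move-intro : ∀ {x} → x ∈ₛ P → x ≢ m → x ∈ₛ move
    move-intro {x} x∈P x≢m rewrite mem-move x | x∈P | dec-false (x ≟ m) x≢m = refl

    d∈move : d ∈ₛ move
    d∈move rewrite mem-move d | dec-true (d ≟ d) refl = ∨-zeroʳ (removeM d)

    move-positive-above : ∀ {x} → x ∈ₛ move → 0 < x → m < x
    move-positive-above {x} x∈ 0<x with move-elim x x∈
    ... | inj₁ (x∈P , x≢m) = ≤∧≢⇒< (multiplicity-minimal P M x∈P 0<x) (x≢m ∘ sym)
    ... | inj₂ refl        = m<d

    move-closed : ∀ x y → x ∈ₛ move → y ∈ₛ move → (x + y) ∈ₛ move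
    move-closed zero    y       _  y∈ = y∈
    move-closed (suc x) zero    x∈ _  = subst (_∈ₛ move) (sym (+-identityʳ (suc x))) x∈
    move-closed (suc x) (suc y) x∈ y∈ with move-elim (suc x) x∈ | move-elim (suc y) y∈
    ... | inj₂ x≡d | _ = memV-beyond move _
      (subst (λ z → F < z + suc y) (sym x≡d) (m<z⇒F<d+z (move-positive-above y∈ z<s)))
    ... | inj₁ _ | inj₂ y≡d = memV-beyond move _
      (subst (λ z → F < suc x + z) (sym y≡d)
        (subst (F <_) (+-comm d (suc x)) (m<z⇒F<d+z (move-positive-above x∈ z<s))))
    ... | inj₁ (x∈P , _) | inj₁ (y∈P , _) =
      move-intro (proj₂ (proj₂ P-semigroup) _ _ x∈P y∈P)
        λ x+y≡m → <-irrefl (sym x+y≡m)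
          (≤-<-trans (multiplicity-minimal P M x∈P z<s) (m<m+n (suc x) z<s))

    move-isNumSemigroup : IsNumSemigroup F move
    move-isNumSemigroup = move-intro (proj₁ P-semigroup) (λ 0≡m → <-irrefl 0≡m 0<m)
                        , F∉move
                        , move-closed
      where
      F∉move : mem move F ≡ false
      F∉move rewrite mem-move F | proj₁ (proj₂ P-semigroup)
                   | dec-false (F ≟ d) (λ F≡d → <-irrefl (sym F≡d) d<F) = refl

    genus-move : genus move ≡ genus P
    genus-move = suc-injective (begin
      suc (countGaps move) ≡⟨ countGaps-clear move removed d agree-move d∈move d∉removed ⟨
      countGaps removed    ≡⟨ countGaps-clear P removed m agree-P m∈P m∉removed ⟩
      suc (countGaps P)    ∎)
      where
      open ≡-Reasoning
      removed : NS F
      removed = tabulateℕ (suc F) removeM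

      mem-removed : ∀ x → memV removed x ≡ removeM x
      mem-removed = memV-tabulateℕ (suc F) removeM removeM-beyond

      agree-P : ∀ x → x ≢ m → memV removed x ≡ memV P x
      agree-P x x≢m rewrite mem-removed x | dec-false (x ≟ m) x≢m = ∧-identityʳ (mem P x)

      m∉removed : memV removed m ≡ false
      m∉removed rewrite mem-removed m | dec-true (m ≟ m) refl = ∧-zeroʳ (mem P m)

      agree-move : ∀ x → x ≢ d → memV removed x ≡ memV move x
      agree-move x x≢d rewrite mem-removed x | mem-move x | dec-false (x ≟ d) x≢d =
        sym (∨-identityʳ (removeM x))

      d∉removed : memV removed d ≡ false
      d∉removed rewrite mem-removed d | d∉P = refl

    SameTheta-move : SameTheta F move P
    SameTheta-move y = to , from
      where
      to : ThetaMem F move y → ThetaMem F P y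
      to (inj₁ (y∈ , not-small)) with move-elim y y∈
      ... | inj₁ (y∈P , _) = inj₁ (y∈P , not-small)
      ... | inj₂ y≡d       = inj₂ (m , m∈P , 0<m , 2m<F , y≡d)
      to (inj₂ (x , x∈ , 0<x , 2x<F , y≡F∸x)) with move-elim x x∈
      ... | inj₁ (x∈P , _) = inj₂ (x , x∈P , 0<x , 2x<F , y≡F∸x)
      ... | inj₂ x≡d       = ⊥-elim (<-asym 2x<F (subst (λ z → F < 2 * z) (sym x≡d) F<2d))

      from : ThetaMem F P y → ThetaMem F move y
      from (inj₁ (y∈P , not-small)) =
        inj₁ (move-intro y∈P (λ { refl → not-small (0<m , 2m<F) }) , not-small)
      from (inj₂ (x , x∈P , 0<x , 2x<F , y≡F∸x)) with x ≟ m
      ... | yes refl = inj₁ ( subst (_∈ₛ move) (sym y≡F∸x) d∈move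
                            , λ (_ , 2y<F) → <-asym (subst (λ z → 2 * z < F) y≡F∸x 2y<F) F<2d )
      ... | no x≢m   = inj₂ (x , move-intro x∈P x≢m , 0<x , 2x<F , y≡F∸x)

    move-InClass : ∀ {g S} → InClass F g S P → InClass F g S move
    move-InClass {S = S} ((_ , genusP) , θP) =
        (move-isNumSemigroup , trans genus-move genusP)
      , SameTheta-trans {P = move} {P} {S} SameTheta-move θP

module _ {F g : ℕ} {S : NS F} (S-smallFree : SmallFree S) where

  WalkToRoot : NS F → Set
  WalkToRoot P = Σ (List (NS F)) λ ys →
    WalkFrom (InClass F g S) (Edge F) P ys × lastV (InClass F g S) (Edge F) P ys ≡ S

  Avoids⇒≡root : ∀ {k P} → InClass F g S P → Avoids k P → ¬ 2 * k < F → P ≡ S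
  Avoids⇒≡root {P = P} P∈[S] P-avoids 2k≮F =
    SameTheta-SmallFree⇒≡ {P = P} {S} (Avoids⇒SmallFree {P = P} P-avoids 2k≮F) S-smallFree
      (proj₂ P∈[S])

  -- Scan k = 1, 2, … keeping P free of (0, k): if k ∈ P then k = m(P), so take the edge.
  walkToRoot : ∀ n k → F ≤ n + k → 0 < k → ∀ P → InClass F g S P → Avoids k P → WalkToRoot P
  walkToRoot zero k F≤k _ P P∈[S] P-avoids =
    [] , tt , Avoids⇒≡root P∈[S] P-avoids
      (λ 2k<F → <-irrefl refl (<-≤-trans 2k<F (≤-trans F≤k (m≤m+n k (k + 0)))))
  walkToRoot (suc n) k F≤1+n+k 0<k P P∈[S] P-avoids with 2 * k <? F | mem P k in k∈P
  ... | no 2k≮F  | _     = [] , tt , Avoids⇒≡root P∈[S] P-avoids 2k≮F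
  ... | yes _    | false = walkToRoot n (suc k) (subst (F ≤_) (sym (+-suc n k)) F≤1+n+k) z<s
                             P P∈[S] (Avoids-extend {P = P} P-avoids k∈P)
  ... | yes 2k<F | true  =
    let move∈[S] = move-InClass {S = S} P∈[S]
        (ys , walk , last) = walkToRoot n (suc k) (subst (F ≤_) (sym (+-suc n k)) F≤1+n+k) z<s
                               move move∈[S] (Edge-avoids {P = P} {move} Edge-move)
    in move ∷ ys , (Edge-move , move∈[S] , walk) , last
    where open Move P (proj₁ (proj₁ P∈[S])) (0<k , k∈P , P-avoids) 2k<F

proposition9 : (F g : ℕ) → 0 < F → 0 < g → (S : NS F) → InEFg F g S →
    GraphIsTreeWithRoot F g S
proposition9 F g _ _ S (_ , m , M , F<2m) P P∈[S] _
  with walkToRoot (elementary⇒SmallFree {S = S} M F<2m) F 1 (m≤m+n F 1) z<s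
                  P P∈[S] (Avoids-one {P = P})
... | ys , walk , last =
  ys , (P∈[S] , walk , last , walk-edges-unique [S] (Edge F) <ₘ-trans <ₘ-irrefl Edge⇒<ₘ ys walk)
     , λ zs (_ , walk′ , last′ , _) →
         walks-to-sink-unique [S] (Edge F) Edge-functional (elementary⇒¬Edge {S = S} M F<2m)
           zs ys walk′ walk last′ last
  where
  [S] : NS F → Set
  [S] = InClass F g S
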